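{- For each positive integer $M$ there are infinitely many real quadratic fields $K=\mathbb{Q}(\sqrt D)$ which do not admit $M$-ary totally positive integral universal (possibly non-classical) quadratic forms over $\mathcal{O}_K$.
   Context: For a totally real number field $K$ with ring of integers $\mathcal{O}_K$, an integral $M$-ary quadratic form over $\mathcal{O}_K$ is $Q(x_1,\dots,x_M)=\sum_{1\le i\le j\le M} a_{ij}x_ix_j$ with all $a_{ij}\in\mathcal{O}_K$ (no parity condition on the cross coefficients $a_{ij}$, $i\neq j$, is imposed; "classical" would mean the cross coefficients are even). $Q$ is totally positive (definite) if for every real embedding $\sigma$ of $K$ the real form $\sum \sigma(a_{ij})x_ix_j$ is positive definite. An element $a\in K$ is totally positive if $\sigma(a)>0$ for all real embeddings $\sigma$. $Q$ is universal if every totally positive $a\in\mathcal{O}_K$ equals $Q(x_1,\dots,x_M)$ for some $x_1,\dots,x_M\in\mathcal{O}_K$. -}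

module Defs where

open import Data.Nat as ℕ using (ℕ; zero; suc)
open import Data.Nat.DivMod using (_%_; _/_)
open import Data.Nat.Divisibility using (_∣_)
open import Data.Integer as ℤ using (ℤ; +_; _+_; _*_; _-_; _<_)
open import Data.Fin using (Fin; zero; suc)
import Data.Fin as F
open import Data.Product using (_×_; _,_; ∃)
open import Relation.Nullary using (¬_; Dec; yes; no)
open import Relation.Binary.PropositionalEquality using (_≡_)

-- D is a squarefree integer > 1; K = ℚ(√D) ranges over all real quadratic fields.
SquareFree : ℕ → Set
SquareFree D = ∀ (p : ℕ) → (p ℕ.* p) ∣ D → p ≡ 1

-- O_K = ℤ[ω] with ω = √D if D ≢ 1 (mod 4), ω = (1+√D)/2 if D ≡ 1 (mod 4).
-- ω² = tr D · ω + cst D.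
tr : ℕ → ℤ
tr D with D % 4
... | suc zero = + 1
... | _        = + 0

cst : ℕ → ℤ
cst D with D % 4
... | suc zero = + (D / 4)   -- (D - 1)/4
... | _        = + D

-- an element (a , b) of O_K stands for a + b ω
𝒪 : Set
𝒪 = ℤ × ℤ

0𝒪 : 𝒪
0𝒪 = (+ 0 , + 0)

add : 𝒪 → 𝒪 → 𝒪
add (a , b) (c , d) = (a + c , b + d)

mul : ℕ → 𝒪 → 𝒪 → 𝒪
mul D (a , b) (c , d) = (a * c + b * d * cst D , a * d + b * c + b * d * tr D)

-- 2(a + b ω) = s + r √D with s = 2a + tr·b, r = (2 - tr)·b.
-- Totally positive: both conjugates (s ± r√D)/2 are > 0, i.e. s > 0 and r²D < s².
TotPos : ℕ → 𝒪 → Set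
TotPos D (a , b) =
  let s = + 2 * a + tr D * b
      r = (+ 2 - tr D) * b
  in (+ 0 < s) × (r * r * + D < s * s)

sumFin : (n : ℕ) → (Fin n → 𝒪) → 𝒪
sumFin zero    f = 0𝒪
sumFin (suc n) f = add (f zero) (sumFin n (λ i → f (suc i)))

-- M-ary quadratic form over O_K: coefficients a i j, only those with i ≤ j are used.
QForm : ℕ → Set
QForm M = Fin M → Fin M → 𝒪

upper : ∀ {M} → (i j : Fin M) → Dec (i F.≤ j) → 𝒪 → 𝒪
upper i j (yes _) v = v
upper i j (no _)  v = 0𝒪

eval : (D M : ℕ) → QForm M → (Fin M → 𝒪) → 𝒪
eval D M Q x = sumFin M (λ i → sumFin M (λ j →
  upper i j (i F.≤? j) (mul D (Q i j) (mul D (x i) (x j)))))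

NonZeroVec : (M : ℕ) → (Fin M → 𝒪) → Set
NonZeroVec M x = ∃ λ i → ¬ (x i ≡ 0𝒪)

TotPosDef : (D M : ℕ) → QForm M → Set
TotPosDef D M Q = ∀ x → NonZeroVec M x → TotPos D (eval D M Q x)

Universal : (D M : ℕ) → QForm M → Set
Universal D M Q = ∀ α → TotPos D α → ∃ λ x → eval D M Q x ≡ α

{-# OPTIONS --safe #-}
module Submission where

-- Take D ≡ 2 (mod 4), so that O_K = ℤ[√D], with D = n² + r slightly above a square, and put
-- β_t = 1 + t n + t √D.  A totally positive a + b √D has a > |b| n, so no β_t is the sum of two
-- totally positive elements, while β_t ≻ 0 as long as t² D < (1 + t n)².  If an M-ary form Q were
-- universal, two of the vectors representing β_0, β_2, …, β_(2·4^M) would be congruent mod 2, say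
-- x = y + 2 w, and the parallelogram law Q x + Q y = 2 (Q w + Q (y + w)) would write β_(i+j) as
-- Q w + Q (y + w), a sum of two totally positive elements (w and y + w are nonzero as Q x ≠ Q y).
-- Squarefree D of this shape exist beyond every bound: D = 2 f (18 s² f + 1) = (6 s f)² + 2 f, and
-- a sieve, using Σ_(d ≥ 5) 1/d² < 1/4, finds f ≡ 1 (mod 6) with f and 18 s² f + 1 squarefree.

open import Defs

module Forms where
  open import Data.Nat as ℕ using (ℕ; suc; _^_)
  open import Data.Nat.DivMod using (_%_)
  import Data.Nat.Properties as ℕP
  open import Data.Nat.Tactic.RingSolver as ℕSolver using ()
  open import Data.Integer as ℤ using (ℤ; +_; -[1+_]; ∣_∣; _+_; _*_; -_; _-_; _<_)
  open import Data.Integer.DivMod using (_%ℕ_; _/ℕ_; n%ℕd<d; a≡a%ℕn+[a/ℕn]*n)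
  import Data.Integer.Properties as ℤP
  open import Data.Integer.Tactic.RingSolver using (solve-∀)
  open import Data.Fin as Fin using (Fin; zero; suc; toℕ)
  import Data.Fin.Properties as FinP
  open import Data.Product using (_×_; _,_; ∃; ∃₂; proj₁; proj₂)
  open import Data.Product.Properties using (≡-dec)
  open import Data.Sum using (_⊎_; inj₁; inj₂)
  open import Data.Empty using (⊥; ⊥-elim)
  open import Function using (_∘_)
  open import Relation.Nullary using (¬_; Dec; yes; no)
  open import Relation.Binary.PropositionalEquality

  twice : 𝒪 → 𝒪
  twice x = add x x

  neg : 𝒪 → 𝒪
  neg (a , b) = (- a , - b)

  Decomposable : ℕ → 𝒪 → Set
  Decomposable D α = ∃₂ λ γ δ → TotPos D γ × TotPos D δ × add γ δ ≡ α

  private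
    interchange : ∀ (a b c d : ℤ) → (a + b) + (c + d) ≡ (a + c) + (b + d)
    interchange = solve-∀

    distrib₁ : ∀ (c q₁ q₂ x₁ x₂ y₁ y₂ : ℤ) →
      q₁ * (x₁ + y₁) + q₂ * (x₂ + y₂) * c ≡ (q₁ * x₁ + q₂ * x₂ * c) + (q₁ * y₁ + q₂ * y₂ * c)
    distrib₁ = solve-∀

    distrib₂ : ∀ (t q₁ q₂ x₁ x₂ y₁ y₂ : ℤ) →
      q₁ * (x₂ + y₂) + q₂ * (x₁ + y₁) + q₂ * (x₂ + y₂) * t ≡
      (q₁ * x₂ + q₂ * x₁ + q₂ * x₂ * t) + (q₁ * y₂ + q₂ * y₁ + q₂ * y₂ * t)
    distrib₂ = solve-∀

    polarised₁ : ∀ (c u₁ u₂ v₁ v₂ w₁ w₂ z₁ z₂ : ℤ) →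
      ((u₁ + (w₁ + w₁)) * (v₁ + (z₁ + z₁)) + (u₂ + (w₂ + w₂)) * (v₂ + (z₂ + z₂)) * c) + (u₁ * v₁ + u₂ * v₂ * c)
      ≡ ((w₁ * z₁ + w₂ * z₂ * c) + (w₁ * z₁ + w₂ * z₂ * c))
        + (((u₁ + w₁) * (v₁ + z₁) + (u₂ + w₂) * (v₂ + z₂) * c) + ((u₁ + w₁) * (v₁ + z₁) + (u₂ + w₂) * (v₂ + z₂) * c))
    polarised₁ = solve-∀

    polarised₂ : ∀ (t u₁ u₂ v₁ v₂ w₁ w₂ z₁ z₂ : ℤ) →
      ((u₁ + (w₁ + w₁)) * (v₂ + (z₂ + z₂)) + (u₂ + (w₂ + w₂)) * (v₁ + (z₁ + z₁)) + (u₂ + (w₂ + w₂)) * (v₂ + (z₂ + z₂)) * t)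
        + (u₁ * v₂ + u₂ * v₁ + u₂ * v₂ * t)
      ≡ ((w₁ * z₂ + w₂ * z₁ + w₂ * z₂ * t) + (w₁ * z₂ + w₂ * z₁ + w₂ * z₂ * t))
        + (((u₁ + w₁) * (v₂ + z₂) + (u₂ + w₂) * (v₁ + z₁) + (u₂ + w₂) * (v₂ + z₂) * t)
          + ((u₁ + w₁) * (v₂ + z₂) + (u₂ + w₂) * (v₁ + z₁) + (u₂ + w₂) * (v₂ + z₂) * t))
    polarised₂ = solve-∀

    neg-mul₁ : ∀ (c a₁ a₂ b₁ b₂ : ℤ) → (- a₁) * (- b₁) + (- a₂) * (- b₂) * c ≡ a₁ * b₁ + a₂ * b₂ * c
    neg-mul₁ = solve-∀

    neg-mul₂ : ∀ (t a₁ a₂ b₁ b₂ : ℤ) →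
      (- a₁) * (- b₂) + (- a₂) * (- b₁) + (- a₂) * (- b₂) * t ≡ a₁ * b₂ + a₂ * b₁ + a₂ * b₂ * t
    neg-mul₂ = solve-∀

    double : ∀ (a : ℤ) → + 2 * a ≡ a + a
    double = solve-∀

    neg-add-double : ∀ (a : ℤ) → - a + (a + a) ≡ a
    neg-add-double = solve-∀

    quotient-shift : ∀ (r a b : ℤ) → r + a * + 2 ≡ (r + b * + 2) + ((a - b) + (a - b))
    quotient-shift = solve-∀

    add-sub : ∀ (a b : ℤ) → a ≡ (a + b) + - b
    add-sub = solve-∀

    sum-zero⇒neg : ∀ (a b : ℤ) → a + b ≡ + 0 → a ≡ - b
    sum-zero⇒neg a b a+b≡0 = begin
      a             ≡⟨ add-sub a b ⟩
      (a + b) + - b ≡⟨ cong (_+ - b) a+b≡0 ⟩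
      + 0 + - b     ≡⟨ ℤP.+-identityˡ (- b) ⟩
      - b           ∎
      where open ≡-Reasoning

  add-interchange : ∀ a b c d → add (add a b) (add c d) ≡ add (add a c) (add b d)
  add-interchange (a₁ , a₂) (b₁ , b₂) (c₁ , c₂) (d₁ , d₂) =
    cong₂ _,_ (interchange a₁ b₁ c₁ d₁) (interchange a₂ b₂ c₂ d₂)

  mul-distribˡ-add : ∀ D q x y → mul D q (add x y) ≡ add (mul D q x) (mul D q y)
  mul-distribˡ-add D (q₁ , q₂) (x₁ , x₂) (y₁ , y₂) =
    cong₂ _,_ (distrib₁ (cst D) q₁ q₂ x₁ x₂ y₁ y₂) (distrib₂ (tr D) q₁ q₂ x₁ x₂ y₁ y₂)

  mul-polarised : ∀ D u v w z →
    add (mul D (add u (twice w)) (add v (twice z))) (mul D u v) ≡ add (twice (mul D w z)) (twice (mul D (add u w) (add v z)))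
  mul-polarised D (u₁ , u₂) (v₁ , v₂) (w₁ , w₂) (z₁ , z₂) =
    cong₂ _,_ (polarised₁ (cst D) u₁ u₂ v₁ v₂ w₁ w₂ z₁ z₂) (polarised₂ (tr D) u₁ u₂ v₁ v₂ w₁ w₂ z₁ z₂)

  mul-neg : ∀ D a b → mul D (neg a) (neg b) ≡ mul D a b
  mul-neg D (a₁ , a₂) (b₁ , b₂) = cong₂ _,_ (neg-mul₁ (cst D) a₁ a₂ b₁ b₂) (neg-mul₂ (tr D) a₁ a₂ b₁ b₂)

  add-twice : ∀ a b → add (twice a) (twice b) ≡ twice (add a b)
  add-twice a b = add-interchange a a b b

  add≡0⇒≡neg : ∀ a b → add a b ≡ 0𝒪 → a ≡ neg b
  add≡0⇒≡neg (a₁ , a₂) (b₁ , b₂) a+b≡0 =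
    cong₂ _,_ (sum-zero⇒neg a₁ b₁ (cong proj₁ a+b≡0)) (sum-zero⇒neg a₂ b₂ (cong proj₂ a+b≡0))

  add-identityʳ : ∀ a → add a 0𝒪 ≡ a
  add-identityʳ (a₁ , a₂) = cong₂ _,_ (ℤP.+-identityʳ a₁) (ℤP.+-identityʳ a₂)

  neg-add-twice : ∀ a → add (neg a) (twice a) ≡ a
  neg-add-twice (a₁ , a₂) = cong₂ _,_ (neg-add-double a₁) (neg-add-double a₂)

  twice-injective : ∀ {a b} → twice a ≡ twice b → a ≡ b
  twice-injective {a₁ , a₂} {b₁ , b₂} 2a≡2b =
    cong₂ _,_ (ℤ-twice-injective (cong proj₁ 2a≡2b)) (ℤ-twice-injective (cong proj₂ 2a≡2b))
    where
    ℤ-twice-injective : ∀ {x y : ℤ} → x + x ≡ y + y → x ≡ y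
    ℤ-twice-injective {x} {y} eq = ℤP.*-cancelˡ-≡ (+ 2) x y (trans (double x) (trans eq (sym (double y))))

  upper-add : ∀ {M} (i j : Fin M) d x y → upper i j d (add x y) ≡ add (upper i j d x) (upper i j d y)
  upper-add i j (yes _) x y = refl
  upper-add i j (no _)  x y = refl

  sumFin-cong : ∀ n {f g : Fin n → 𝒪} → (∀ i → f i ≡ g i) → sumFin n f ≡ sumFin n g
  sumFin-cong ℕ.zero    f≗g = refl
  sumFin-cong (ℕ.suc n) f≗g = cong₂ add (f≗g zero) (sumFin-cong n (λ i → f≗g (suc i)))

  sumFin-add : ∀ n (f g : Fin n → 𝒪) → sumFin n (λ i → add (f i) (g i)) ≡ add (sumFin n f) (sumFin n g)
  sumFin-add ℕ.zero    f g = refl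
  sumFin-add (ℕ.suc n) f g = trans (cong (add (add (f zero) (g zero))) (sumFin-add n (λ i → f (suc i)) (λ i → g (suc i))))
                                 (add-interchange (f zero) (g zero) _ _)

  -- eval D M Q x is definitionally pairing D Q (λ i j → mul D (x i) (x j)).
  pairing : (D : ℕ) {M : ℕ} → QForm M → (Fin M → Fin M → 𝒪) → 𝒪
  pairing D {M} Q X = sumFin M λ i → sumFin M λ j → upper i j (i Fin.≤? j) (mul D (Q i j) (X i j))

  module _ (D : ℕ) {M : ℕ} (Q : QForm M) where

    pairing-cong : ∀ {X Y} → (∀ i j → X i j ≡ Y i j) → pairing D Q X ≡ pairing D Q Y
    pairing-cong X≗Y = sumFin-cong M λ i → sumFin-cong M λ j → cong (upper i j _ ∘ mul D (Q i j)) (X≗Y i j)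

    pairing-add : ∀ X Y → pairing D Q (λ i j → add (X i j) (Y i j)) ≡ add (pairing D Q X) (pairing D Q Y)
    pairing-add X Y = begin
      pairing D Q (λ i j → add (X i j) (Y i j))
        ≡⟨ sumFin-cong M (λ i → sumFin-cong M λ j →
             trans (cong (upper i j _) (mul-distribˡ-add D (Q i j) _ _)) (upper-add i j _ _ _)) ⟩
      sumFin M (λ i → sumFin M λ j → add (term X i j) (term Y i j))
        ≡⟨ sumFin-cong M (λ i → sumFin-add M (term X i) (term Y i)) ⟩
      sumFin M (λ i → add (sumFin M (term X i)) (sumFin M (term Y i)))
        ≡⟨ sumFin-add M _ _ ⟩
      add (pairing D Q X) (pairing D Q Y) ∎
      where
      open ≡-Reasoning
      term : (Fin M → Fin M → 𝒪) → Fin M → Fin M → 𝒪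
      term X i j = upper i j (i Fin.≤? j) (mul D (Q i j) (X i j))

    pairing-twice : ∀ X → pairing D Q (λ i j → twice (X i j)) ≡ twice (pairing D Q X)
    pairing-twice X = pairing-add X X

    eval-cong : ∀ {x y} → (∀ c → x c ≡ y c) → eval D M Q x ≡ eval D M Q y
    eval-cong x≗y = pairing-cong λ i j → cong₂ (mul D) (x≗y i) (x≗y j)

    eval-neg : ∀ x → eval D M Q (neg ∘ x) ≡ eval D M Q x
    eval-neg x = pairing-cong λ i j → mul-neg D (x i) (x j)

    eval-parallelogram : ∀ y w →
      add (eval D M Q (λ c → add (y c) (twice (w c)))) (eval D M Q y)
        ≡ add (twice (eval D M Q w)) (twice (eval D M Q (λ c → add (y c) (w c))))
    eval-parallelogram y w = begin
      add (pairing D Q (products x)) (pairing D Q (products y))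
        ≡⟨ pairing-add (products x) (products y) ⟨
      pairing D Q (λ i j → add (products x i j) (products y i j))
        ≡⟨ pairing-cong (λ i j → mul-polarised D (y i) (y j) (w i) (w j)) ⟩
      pairing D Q (λ i j → add (twice (products w i j)) (twice (products v i j)))
        ≡⟨ pairing-add _ _ ⟩
      add (pairing D Q (λ i j → twice (products w i j))) (pairing D Q (λ i j → twice (products v i j)))
        ≡⟨ cong₂ add (pairing-twice (products w)) (pairing-twice (products v)) ⟩
      add (twice (eval D M Q w)) (twice (eval D M Q v)) ∎
      where
      open ≡-Reasoning
      x v : Fin M → 𝒪
      x c = add (y c) (twice (w c))
      v c = add (y c) (w c)
      products : (Fin M → 𝒪) → Fin M → Fin M → 𝒪
      products x i j = mul D (x i) (x j)

  _≟𝒪_ : (x y : 𝒪) → Dec (x ≡ y)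
  _≟𝒪_ = ≡-dec ℤ._≟_ ℤ._≟_

  zero-or-nonZero : ∀ {M} (w : Fin M → 𝒪) → (∀ c → w c ≡ 0𝒪) ⊎ NonZeroVec M w
  zero-or-nonZero {M} w with FinP.all? (λ c → w c ≟𝒪 0𝒪)
  ... | yes w≡0 = inj₁ w≡0
  ... | no  w≢0 = inj₂ (FinP.¬∀⟶∃¬ M _ (λ c → w c ≟𝒪 0𝒪) w≢0)

  module _ {D M : ℕ} {Q : QForm M} (Q≻0 : TotPosDef D M Q) where

    congruent-values-decompose : ∀ x y w → (∀ c → x c ≡ add (y c) (twice (w c))) →
      eval D M Q x ≢ eval D M Q y →
      ∃ λ β → Decomposable D β × add (eval D M Q x) (eval D M Q y) ≡ twice β
    congruent-values-decompose x y w x≡y+2w Qx≢Qy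
      with zero-or-nonZero w | zero-or-nonZero (λ c → add (y c) (w c))
    ... | inj₁ w≡0 | _ = ⊥-elim (Qx≢Qy (eval-cong D Q x≡y))
      where
      x≡y : ∀ c → x c ≡ y c
      x≡y c = trans (x≡y+2w c) (trans (cong (add (y c) ∘ twice) (w≡0 c)) (add-identityʳ (y c)))
    ... | inj₂ _ | inj₁ y+w≡0 = ⊥-elim (Qx≢Qy (trans (eval-cong D Q x≡w) (sym (trans (eval-cong D Q y≡-w) (eval-neg D Q w)))))
      where
      y≡-w : ∀ c → y c ≡ neg (w c)
      y≡-w c = add≡0⇒≡neg (y c) (w c) (y+w≡0 c)
      x≡w : ∀ c → x c ≡ w c
      x≡w c = trans (x≡y+2w c) (trans (cong (λ z → add z (twice (w c))) (y≡-w c)) (neg-add-twice (w c)))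
    ... | inj₂ w≢0 | inj₂ y+w≢0 =
      add γ δ , (γ , δ , Q≻0 w w≢0 , Q≻0 (λ c → add (y c) (w c)) y+w≢0 , refl) ,
      trans (cong (λ z → add z (eval D M Q y)) (eval-cong D Q x≡y+2w))
            (trans (eval-parallelogram D Q y w) (add-twice γ δ))
      where
      γ = eval D M Q w
      δ = eval D M Q (λ c → add (y c) (w c))

  parity : ℤ → Fin 2
  parity a = Fin.fromℕ< (n%ℕd<d a 2)

  half-difference : ℤ → ℤ → ℤ
  half-difference a b = a /ℕ 2 - b /ℕ 2

  parity-≡ : ∀ a b → parity a ≡ parity b → a ≡ b + (half-difference a b + half-difference a b)
  parity-≡ a b pa≡pb = begin
    a                                       ≡⟨ a≡a%ℕn+[a/ℕn]*n a 2 ⟩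
    + (a %ℕ 2) + (a /ℕ 2) * + 2             ≡⟨ cong (λ r → + r + (a /ℕ 2) * + 2) a%2≡b%2 ⟩
    + (b %ℕ 2) + (a /ℕ 2) * + 2             ≡⟨ quotient-shift (+ (b %ℕ 2)) (a /ℕ 2) (b /ℕ 2) ⟩
    (+ (b %ℕ 2) + (b /ℕ 2) * + 2) + (h + h) ≡⟨ cong (_+ (h + h)) (a≡a%ℕn+[a/ℕn]*n b 2) ⟨
    b + (h + h)                             ∎
    where
    open ≡-Reasoning
    h = half-difference a b
    a%2≡b%2 : a %ℕ 2 ≡ b %ℕ 2
    a%2≡b%2 = FinP.fromℕ<-injective _ _ (n%ℕd<d a 2) (n%ℕd<d b 2) pa≡pb

  residue : 𝒪 → Fin 4
  residue (a , b) = Fin.combine (parity a) (parity b)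

  half-difference𝒪 : 𝒪 → 𝒪 → 𝒪
  half-difference𝒪 (a₁ , a₂) (b₁ , b₂) = (half-difference a₁ b₁ , half-difference a₂ b₂)

  residue-≡ : ∀ x y → residue x ≡ residue y → x ≡ add y (twice (half-difference𝒪 x y))
  residue-≡ (a₁ , a₂) (b₁ , b₂) rx≡ry with FinP.combine-injective (parity a₁) (parity a₂) (parity b₁) (parity b₂) rx≡ry
  ... | p₁ , p₂ = cong₂ _,_ (parity-≡ a₁ b₁ p₁) (parity-≡ a₂ b₂ p₂)

  residues : ∀ {M} → (Fin M → 𝒪) → Fin (4 ^ M)
  residues x = Fin.funToFin (residue ∘ x)

  residues-≡ : ∀ {M} (x y : Fin M → 𝒪) → residues x ≡ residues y → ∀ c → residue (x c) ≡ residue (y c)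
  residues-≡ x y rx≡ry c = begin
    residue (x c)                         ≡⟨ FinP.finToFun-funToFin (residue ∘ x) c ⟨
    Fin.finToFun (residues x) c           ≡⟨ cong (λ r → Fin.finToFun r c) rx≡ry ⟩
    Fin.finToFun (residues y) c           ≡⟨ FinP.finToFun-funToFin (residue ∘ y) c ⟩
    residue (y c)                         ∎
    where open ≡-Reasoning

  no-universal-form : ∀ {D M} (α : Fin (suc (4 ^ M)) → 𝒪) → (∀ k → TotPos D (α k)) →
    (∀ {i j} → i Fin.< j → α i ≢ α j) →
    (∀ i j → ∃ λ β → ¬ Decomposable D β × add (α i) (α j) ≡ twice β) →
    ∀ Q → TotPosDef D M Q → ¬ Universal D M Q
  no-universal-form {D} {M} α α≻0 α-distinct α-indecomposable Q Q≻0 universal =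
    congruent-pair-contradicts (FinP.pigeonhole (ℕP.n<1+n (4 ^ M)) (λ k → residues (rep k)))
    where
    rep : Fin (suc (4 ^ M)) → Fin M → 𝒪
    rep k = proj₁ (universal (α k) (α≻0 k))
    represents : ∀ k → eval D M Q (rep k) ≡ α k
    represents k = proj₂ (universal (α k) (α≻0 k))

    congruent-pair-contradicts : (∃₂ λ i j → i Fin.< j × residues (rep i) ≡ residues (rep j)) → ⊥
    congruent-pair-contradicts (i , j , i<j , ri≡rj)
      with congruent-values-decompose {Q = Q} Q≻0 (rep i) (rep j) (λ c → half-difference𝒪 (rep i c) (rep j c))
             (λ c → residue-≡ (rep i c) (rep j c) (residues-≡ (rep i) (rep j) ri≡rj c))
             (λ Qi≡Qj → α-distinct i<j (trans (sym (represents i)) (trans Qi≡Qj (represents j))))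
         | α-indecomposable i j
    ... | β′ , β′-decomposable , sum≡2β′ | β , β-indecomposable , sum≡2β =
      β-indecomposable (subst (Decomposable D) β′≡β β′-decomposable)
      where
      β′≡β : β′ ≡ β
      β′≡β = twice-injective (trans (sym sum≡2β′) (trans (cong₂ add (represents i) (represents j)) sum≡2β))

  private
    trace-free-s : ∀ (a b : ℤ) → + 2 * a + + 0 * b ≡ + 2 * a
    trace-free-s = solve-∀

    trace-free-r : ∀ (b d : ℤ) → (+ 2 - + 0) * b * ((+ 2 - + 0) * b) * d ≡ + 4 * (b * b * d)
    trace-free-r = solve-∀

    square-double : ∀ (a : ℤ) → (+ 2 * a) * (+ 2 * a) ≡ + 4 * (a * a)
    square-double = solve-∀

    square-of-product : ∀ x n → (x ℕ.* n) ℕ.* (x ℕ.* n) ≡ x ℕ.* x ℕ.* (n ℕ.* n)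
    square-of-product = ℕSolver.solve-∀

    two-successors : ∀ x y n → suc (suc ((x ℕ.+ y) ℕ.* n)) ≡ suc (x ℕ.* n) ℕ.+ suc (y ℕ.* n)
    two-successors = ℕSolver.solve-∀

    halves-rational : ∀ i j n →
      suc (2 ℕ.* i ℕ.* n) ℕ.+ suc (2 ℕ.* j ℕ.* n) ≡ suc ((i ℕ.+ j) ℕ.* n) ℕ.+ suc ((i ℕ.+ j) ℕ.* n)
    halves-rational = ℕSolver.solve-∀

    halves-irrational : ∀ i j → 2 ℕ.* i ℕ.+ 2 ℕ.* j ≡ (i ℕ.+ j) ℕ.+ (i ℕ.+ j)
    halves-irrational = ℕSolver.solve-∀

    square≡∣∣² : ∀ b → b * b ≡ + (∣ b ∣ ℕ.* ∣ b ∣)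
    square≡∣∣² (+ n)    = sym (ℤP.pos-* n n)
    square≡∣∣² -[1+ n ] = refl

  module _ {D : ℕ} (tr≡0 : tr D ≡ + 0) where

    TotPos⇒ : ∀ {a b} → TotPos D (a , b) → + 0 < a × b * b * + D < a * a
    TotPos⇒ {a} {b} (s>0 , r²D<s²) rewrite tr≡0 =
      ℤP.*-cancelˡ-<-nonNeg (+ 2) (subst (+ 0 <_) (trace-free-s a b) s>0) ,
      ℤP.*-cancelˡ-<-nonNeg (+ 4)
        (subst₂ _<_ (trace-free-r b (+ D)) (trans (cong (λ s → s * s) (trace-free-s a b)) (square-double a)) r²D<s²)

    TotPos⇐ : ∀ {a b} → + 0 < a → b * b * + D < a * a → TotPos D (a , b)
    TotPos⇐ {a} {b} a>0 b²D<a² rewrite tr≡0 =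
      subst (+ 0 <_) (sym (trace-free-s a b)) (ℤP.*-monoˡ-<-pos (+ 2) a>0) ,
      subst₂ _<_ (sym (trace-free-r b (+ D))) (sym (trans (cong (λ s → s * s) (trace-free-s a b)) (square-double a)))
        (ℤP.*-monoˡ-<-pos (+ 4) b²D<a²)

    TotPos-ℕ⇐ : ∀ a b → 0 ℕ.< a → b ℕ.* b ℕ.* D ℕ.< a ℕ.* a → TotPos D (+ a , + b)
    TotPos-ℕ⇐ a b a>0 b²D<a² = TotPos⇐ (ℤ.+<+ a>0)
      (subst₂ _<_ (trans (ℤP.pos-* (b ℕ.* b) D) (cong (_* + D) (ℤP.pos-* b b))) (ℤP.pos-* a a) (ℤ.+<+ b²D<a²))

    -- since (|b| n)² ≤ b² D < a²
    TotPos⇒dominates : ∀ n a b → n ℕ.* n ℕ.≤ D → TotPos D (a , b) → ∃ λ a′ → a ≡ + a′ × ∣ b ∣ ℕ.* n ℕ.< a′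
    TotPos⇒dominates n a b n²≤D ab≻0 with TotPos⇒ {a} {b} ab≻0
    ... | a>0 , b²D<a² with a
    ...   | + a′ = a′ , refl , ℕP.≰⇒> λ a′≤bn → ℕP.<-irrefl refl (ℕP.≤-<-trans (bound a′≤bn) b²D<a²′)
      where
      x = ∣ b ∣
      b²D<a²′ : x ℕ.* x ℕ.* D ℕ.< a′ ℕ.* a′
      b²D<a²′ = ℤP.drop‿+<+
        (subst₂ _<_ (trans (cong (_* + D) (square≡∣∣² b)) (sym (ℤP.pos-* (x ℕ.* x) D))) (sym (ℤP.pos-* a′ a′)) b²D<a²)
      bound : a′ ℕ.≤ x ℕ.* n → a′ ℕ.* a′ ℕ.≤ x ℕ.* x ℕ.* D
      bound a′≤xn = ℕP.≤-trans (ℕP.*-mono-≤ a′≤xn a′≤xn)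
        (ℕP.≤-trans (ℕP.≤-reflexive (square-of-product x n)) (ℕP.*-monoʳ-≤ (x ℕ.* x) n²≤D))
    ...   | -[1+ _ ] with () ← a>0

  tr≡0 : ∀ D → D % 4 ≡ 2 → tr D ≡ + 0
  tr≡0 D D%4≡2 with D % 4 | D%4≡2
  ... | .2 | refl = refl

  β : ℕ → ℕ → 𝒪
  β n m = (+ suc (m ℕ.* n) , + m)

  β-indecomposable : ∀ {D} n m → tr D ≡ + 0 → n ℕ.* n ℕ.≤ D → ¬ Decomposable D (β n m)
  β-indecomposable {D} n m tr≡0 n²≤D ((a₁ , b₁) , (a₂ , b₂) , γ≻0 , δ≻0 , γ+δ≡β)
    with TotPos⇒dominates tr≡0 n a₁ b₁ n²≤D γ≻0 | TotPos⇒dominates tr≡0 n a₂ b₂ n²≤D δ≻0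
  ... | a₁′ , refl , b₁n<a₁′ | a₂′ , refl , b₂n<a₂′ = ℕP.<-irrefl refl (begin-strict
    suc (m ℕ.* n)                         <⟨ ℕ.s≤s (ℕP.n<1+n _) ⟩
    suc (suc (m ℕ.* n))                   ≤⟨ ℕ.s≤s (ℕ.s≤s (ℕP.*-monoˡ-≤ n m≤b₁+b₂)) ⟩
    suc (suc ((∣ b₁ ∣ ℕ.+ ∣ b₂ ∣) ℕ.* n)) ≡⟨ two-successors ∣ b₁ ∣ ∣ b₂ ∣ n ⟩
    suc (∣ b₁ ∣ ℕ.* n) ℕ.+ suc (∣ b₂ ∣ ℕ.* n) ≤⟨ ℕP.+-mono-≤ b₁n<a₁′ b₂n<a₂′ ⟩
    a₁′ ℕ.+ a₂′                           ≡⟨ ℤP.+-injective (trans (ℤP.pos-+ a₁′ a₂′) (cong proj₁ γ+δ≡β)) ⟩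
    suc (m ℕ.* n)                         ∎)
    where
    open ℕP.≤-Reasoning
    m≤b₁+b₂ : m ℕ.≤ ∣ b₁ ∣ ℕ.+ ∣ b₂ ∣
    m≤b₁+b₂ = subst (ℕ._≤ ∣ b₁ ∣ ℕ.+ ∣ b₂ ∣) (cong (∣_∣ ∘ proj₂) γ+δ≡β) (ℤP.∣i+j∣≤∣i∣+∣j∣ b₁ b₂)

  β-halves : ∀ n i j → add (β n (2 ℕ.* i)) (β n (2 ℕ.* j)) ≡ twice (β n (i ℕ.+ j))
  β-halves n i j = cong₂ _,_
    (lift-sum (suc (2 ℕ.* i ℕ.* n)) (suc (2 ℕ.* j ℕ.* n)) (suc ((i ℕ.+ j) ℕ.* n)) (suc ((i ℕ.+ j) ℕ.* n))
              (halves-rational i j n))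
    (lift-sum (2 ℕ.* i) (2 ℕ.* j) (i ℕ.+ j) (i ℕ.+ j) (halves-irrational i j))
    where
    lift-sum : ∀ a b c d → a ℕ.+ b ≡ c ℕ.+ d → + a + + b ≡ + c + + d
    lift-sum a b c d eq = trans (sym (ℤP.pos-+ a b)) (trans (cong +_ eq) (ℤP.pos-+ c d))

  no-universal-form-ℤ[√D] : ∀ {D M} n → tr D ≡ + 0 → n ℕ.* n ℕ.≤ D →
    (∀ t → t ℕ.≤ 2 ℕ.* 4 ^ M → t ℕ.* t ℕ.* D ℕ.< suc (t ℕ.* n) ℕ.* suc (t ℕ.* n)) →
    ∀ Q → TotPosDef D M Q → ¬ Universal D M Q
  no-universal-form-ℤ[√D] {D} {M} n tr≡0 n²≤D β≻0 =
    no-universal-form α α≻0 α-distinct λ i j →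
      β n (toℕ i ℕ.+ toℕ j) , β-indecomposable n (toℕ i ℕ.+ toℕ j) tr≡0 n²≤D , β-halves n (toℕ i) (toℕ j)
    where
    α : Fin (suc (4 ^ M)) → 𝒪
    α k = β n (2 ℕ.* toℕ k)
    α≻0 : ∀ k → TotPos D (α k)
    α≻0 k = TotPos-ℕ⇐ {D} tr≡0 _ (2 ℕ.* toℕ k) (ℕ.s≤s ℕ.z≤n) (β≻0 _ (ℕP.*-monoʳ-≤ 2 (ℕ.s≤s⁻¹ (FinP.toℕ<n k))))
    α-distinct : ∀ {i j} → i Fin.< j → α i ≢ α j
    α-distinct {i} {j} i<j αi≡αj =
      ℕP.<-irrefl (ℕP.*-cancelˡ-≡ (toℕ i) (toℕ j) 2 (ℤP.+-injective (cong proj₂ αi≡αj))) i<j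

module Counting where
  open import Data.Nat using (ℕ; zero; suc; _+_; _*_; _∸_; _≤_; _<_; z≤n; s≤s)
  open import Data.Nat.Base using (s≤s⁻¹; >-nonZero)
  open import Data.Nat.Properties
  open import Data.Nat.Divisibility using (_∣_; _∣?_; ∣m+n∣m⇒∣n; ∣⇒≤; ∣-trans; ∣m⇒∣m*n)
  open import Data.Nat.Coprimality using (Coprime; coprime-divisor)
  open import Data.Nat.Tactic.RingSolver using (solve-∀)
  open import Data.Bool using (if_then_else_)
  open import Data.Product using (_×_; _,_; ∃)
  open import Data.Sum using (_⊎_; inj₁; inj₂)
  open import Level using (Level)
  open import Relation.Nullary using (¬_; does; yes; no; contradiction)
  open import Relation.Nullary.Decidable using (_⊎-dec_)
  open import Relation.Unary using (Pred; Decidable)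
  open import Relation.Unary.Properties using (_∪?_)
  open import Relation.Binary.PropositionalEquality

  private
    variable
      ℓ : Level
      P Q : Pred ℕ ℓ

  count : {P : Pred ℕ ℓ} → Decidable P → ℕ → ℕ
  count P? zero    = 0
  count P? (suc L) = if does (P? L) then suc (count P? L) else count P? L

  count-none : (P? : Decidable P) → (∀ {j} → ¬ P j) → ∀ L → count P? L ≡ 0
  count-none P? ¬P zero = refl
  count-none P? ¬P (suc L) with P? L
  ... | yes p = contradiction p ¬P
  ... | no  _ = count-none P? ¬P L

  count-mono : (P? : Decidable P) (Q? : Decidable Q) → (∀ {j} → P j → Q j) → ∀ L → count P? L ≤ count Q? L
  count-mono P? Q? P⊆Q zero = z≤n
  count-mono P? Q? P⊆Q (suc L) with P? L | Q? L
  ... | yes _ | yes _ = s≤s (count-mono P? Q? P⊆Q L)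
  ... | yes p | no ¬q = contradiction (P⊆Q p) ¬q
  ... | no  _ | yes _ = m≤n⇒m≤1+n (count-mono P? Q? P⊆Q L)
  ... | no  _ | no  _ = count-mono P? Q? P⊆Q L

  count-∪ : (P? : Decidable P) (Q? : Decidable Q) → ∀ L → count (P? ∪? Q?) L ≤ count P? L + count Q? L
  count-∪ P? Q? zero = z≤n
  count-∪ P? Q? (suc L) with P? L | Q? L
  ... | yes _ | yes _ = s≤s (≤-trans (count-∪ P? Q? L) (+-monoʳ-≤ (count P? L) (n≤1+n _)))
  ... | yes _ | no  _ = s≤s (count-∪ P? Q? L)
  ... | no  _ | yes _ = ≤-trans (s≤s (count-∪ P? Q? L)) (≤-reflexive (sym (+-suc _ _)))
  ... | no  _ | no  _ = count-∪ P? Q? L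

  count<⇒∃¬ : (P? : Decidable P) → ∀ L → count P? L < L → ∃ λ j → j < L × ¬ P j
  count<⇒∃¬ P? (suc L) c<L with P? L
  ... | no ¬p = L , ≤-refl , ¬p
  ... | yes _ with j , j<L , ¬p ← count<⇒∃¬ P? L (s≤s⁻¹ c<L) = j , m<n⇒m<1+n j<L , ¬p

  ∑< : ℕ → (ℕ → ℕ) → ℕ
  ∑< zero    f = 0
  ∑< (suc K) f = ∑< K f + f K

  syntax ∑< K (λ i → e) = ∑[ i < K ] e

  ∑-mono : ∀ K {f g : ℕ → ℕ} → (∀ i → i < K → f i ≤ g i) → ∑< K f ≤ ∑< K g
  ∑-mono zero    f≤g = z≤n
  ∑-mono (suc K) f≤g = +-mono-≤ (∑-mono K λ i i<K → f≤g i (m<n⇒m<1+n i<K)) (f≤g K ≤-refl)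

  ∑-+ : ∀ K (f g : ℕ → ℕ) → ∑[ i < K ] (f i + g i) ≡ ∑< K f + ∑< K g
  ∑-+ zero    f g = refl
  ∑-+ (suc K) f g = trans (cong (_+ (f K + g K)) (∑-+ K f g)) (+-interchange (∑< K f) (∑< K g) (f K) (g K))
    where
    +-interchange : ∀ a b c d → (a + b) + (c + d) ≡ (a + c) + (b + d)
    +-interchange = solve-∀

  union-bound : {P : ℕ → Pred ℕ ℓ} (P? : ∀ i → Decidable (P i)) → ∀ K L →
    count (λ j → anyUpTo? (λ i → P? i j) K) L ≤ ∑[ i < K ] count (P? i) L
  union-bound P? zero L = ≤-reflexive (count-none _ (λ { (_ , () , _) }) L)
  union-bound {P = P} P? (suc K) L = begin
    count (λ j → anyUpTo? (λ i → P? i j) (suc K)) L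
      ≤⟨ count-mono _ ((λ j → anyUpTo? (λ i → P? i j) K) ∪? P? K) split L ⟩
    count ((λ j → anyUpTo? (λ i → P? i j) K) ∪? P? K) L
      ≤⟨ count-∪ _ (P? K) L ⟩
    count (λ j → anyUpTo? (λ i → P? i j) K) L + count (P? K) L
      ≤⟨ +-monoˡ-≤ _ (union-bound P? K L) ⟩
    ∑[ i < suc K ] count (P? i) L ∎
    where
    open ≤-Reasoning
    split : ∀ {j} → (∃ λ i → i < suc K × P i j) → (∃ λ i → i < K × P i j) ⊎ P K j
    split (i , i<1+K , p) with m<1+n⇒m<n∨m≡n i<1+K
    ... | inj₁ i<K  = inj₁ (i , i<K , p)
    ... | inj₂ refl = inj₂ p

  private
    linear : ∀ b A x z → b + A * (x + z) ≡ (b + A * x) + A * z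
    linear = solve-∀

    split-last : ∀ K S c → (4 + K) * (5 + K) * (4 * (5 + K) * (S + c))
      ≡ (5 + K) * (5 + K) * (4 * (4 + K) * S) + 4 * (4 + K) * (c * ((5 + K) * (5 + K)))
    split-last = solve-∀

    telescope : ∀ K L → (5 + K) * (5 + K) * (K * (L + 4 * (4 + K))) + 4 * (4 + K) * (L + (5 + K) * (5 + K)) + 4 * L
      ≡ (4 + K) * (5 + K) * ((1 + K) * (L + 4 * (5 + K)))
    telescope = solve-∀

    budget : ∀ K → 1 + (K * ((1 + 4 * K) + 4 * (4 + K)) + K * ((1 + 4 * K) + 4 * (4 + K))) + (15 + 34 * K) ≡ 4 * (4 + K) * (1 + 4 * K)
    budget = solve-∀

  Sparse : ℕ → Pred ℕ ℓ → Set ℓ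
  Sparse m P = ∀ {x y} → P x → P y → x < y → x + m ≤ y

  module _ {m : ℕ} {P : Pred ℕ ℓ} (P? : Decidable P) (sparse : Sparse m P) where

    count-sparse-before : ∀ {y} → P y → ∀ L → L ≤ y → count P? L * m ≤ y
    count-sparse-before Py zero    _   = z≤n
    count-sparse-before Py (suc L) L<y with P? L
    ... | no  _  = count-sparse-before Py L (<⇒≤ L<y)
    ... | yes PL = begin
      m + count P? L * m ≤⟨ +-monoʳ-≤ m (count-sparse-before PL L ≤-refl) ⟩
      m + L             ≡⟨ +-comm m L ⟩
      L + m             ≤⟨ sparse PL Py L<y ⟩
      _                 ∎
      where open ≤-Reasoning

    count-sparse : ∀ L → count P? L * m ≤ L + m
    count-sparse zero    = z≤n
    count-sparse (suc L) with P? L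
    ... | no  _  = m≤n⇒m≤1+n (count-sparse L)
    ... | yes PL = begin
      m + count P? L * m ≤⟨ +-monoʳ-≤ m (count-sparse-before PL L ≤-refl) ⟩
      m + L             ≡⟨ +-comm m L ⟩
      L + m             ≤⟨ n≤1+n _ ⟩
      suc L + m         ∎
      where open ≤-Reasoning

  -- A is invertible modulo m, so all solutions j of m ∣ b + A j are congruent modulo m.
  sparse-∣ : ∀ {A b} m → Coprime A b → Sparse m (λ j → m ∣ b + A * j)
  sparse-∣ {A} {b} m A⊥b {x} {y} m∣x m∣y x<y = begin
    x + m           ≤⟨ +-monoʳ-≤ x m≤y∸x ⟩
    x + (y ∸ x)     ≡⟨ m+[n∸m]≡n (<⇒≤ x<y) ⟩
    y               ∎
    where
    open ≤-Reasoning
    shift : b + A * y ≡ (b + A * x) + A * (y ∸ x)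
    shift = trans (cong (λ z → b + A * z) (sym (m+[n∸m]≡n (<⇒≤ x<y)))) (linear b A x (y ∸ x))
    m⊥A : Coprime m A
    m⊥A {c} (c∣m , c∣A) =
      A⊥b (c∣A , ∣m+n∣m⇒∣n (subst (c ∣_) (+-comm b (A * x)) (∣-trans c∣m m∣x)) (∣m⇒∣m*n x c∣A))
    m≤y∸x : m ≤ y ∸ x
    m≤y∸x = ∣⇒≤ {{>-nonZero (m<n⇒0<n∸m x<y)}}
      (coprime-divisor m⊥A (∣m+n∣m⇒∣n (subst (m ∣_) shift m∣y) m∣x))

  -- Σ_{d ≥ 5} 1/d² < Σ_{d ≥ 5} 1/(d(d-1)) = 1/4, with denominators cleared.
  ∑-inverse-squares : ∀ L K (c : ℕ → ℕ) → (∀ i → i < K → c i * ((5 + i) * (5 + i)) ≤ L + (5 + i) * (5 + i)) →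
    4 * (4 + K) * ∑< K c ≤ K * (L + 4 * (4 + K))
  ∑-inverse-squares L zero    c bound = z≤n
  ∑-inverse-squares L (suc K) c bound = *-cancelˡ-≤ ((4 + K) * (5 + K)) (begin
    (4 + K) * (5 + K) * (4 * (5 + K) * (S + c K))
      ≡⟨ split-last K S (c K) ⟩
    (5 + K) * (5 + K) * (4 * (4 + K) * S) + 4 * (4 + K) * (c K * ((5 + K) * (5 + K)))
      ≤⟨ +-mono-≤ (*-monoʳ-≤ ((5 + K) * (5 + K)) (∑-inverse-squares L K c λ i i<K → bound i (m<n⇒m<1+n i<K)))
                  (*-monoʳ-≤ (4 * (4 + K)) (bound K ≤-refl)) ⟩
    (5 + K) * (5 + K) * (K * (L + 4 * (4 + K))) + 4 * (4 + K) * (L + (5 + K) * (5 + K))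
      ≤⟨ m≤m+n _ (4 * L) ⟩
    (5 + K) * (5 + K) * (K * (L + 4 * (4 + K))) + 4 * (4 + K) * (L + (5 + K) * (5 + K)) + 4 * L
      ≡⟨ telescope K L ⟩
    (4 + K) * (5 + K) * (suc K * (L + 4 * (5 + K))) ∎)
    where
    open ≤-Reasoning
    S = ∑< K c

  -- For each 5 ≤ d < 5 + K and each progression, d² divides at most (4K + 1)/d² + 1 of the values at
  -- j ≤ 4K (count-sparse), and these bounds add up to less than 4K + 1.
  module _ {A b A′ b′ : ℕ} (A⊥b : Coprime A b) (A′⊥b′ : Coprime A′ b′) (K : ℕ) where

    private
      sq : ℕ → ℕ
      sq i = (5 + i) * (5 + i)

      divisible? : ∀ i → Decidable (λ j → sq i ∣ b + A * j ⊎ sq i ∣ b′ + A′ * j)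
      divisible? i j = (sq i ∣? b + A * j) ⊎-dec (sq i ∣? b′ + A′ * j)

      bad? : Decidable (λ j → ∃ λ i → i < K × (sq i ∣ b + A * j ⊎ sq i ∣ b′ + A′ * j))
      bad? j = anyUpTo? (λ i → divisible? i j) K

      count-bad : ∀ L → 4 * (4 + K) * count bad? L ≤ K * (L + 4 * (4 + K)) + K * (L + 4 * (4 + K))
      count-bad L = begin
        4 * (4 + K) * count bad? L
          ≤⟨ *-monoʳ-≤ (4 * (4 + K)) (≤-trans (union-bound divisible? K L)
               (≤-trans (∑-mono K (λ i _ → count-∪ (λ j → sq i ∣? b + A * j) (λ j → sq i ∣? b′ + A′ * j) L))
                        (≤-reflexive (∑-+ K f g)))) ⟩
        4 * (4 + K) * (∑< K f + ∑< K g)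
          ≡⟨ *-distribˡ-+ (4 * (4 + K)) (∑< K f) (∑< K g) ⟩
        4 * (4 + K) * ∑< K f + 4 * (4 + K) * ∑< K g
          ≤⟨ +-mono-≤ (∑-inverse-squares L K f λ i _ → count-sparse (λ j → sq i ∣? b + A * j) (sparse-∣ (sq i) A⊥b) L)
                      (∑-inverse-squares L K g λ i _ → count-sparse (λ j → sq i ∣? b′ + A′ * j) (sparse-∣ (sq i) A′⊥b′) L) ⟩
        K * (L + 4 * (4 + K)) + K * (L + 4 * (4 + K)) ∎
        where
        open ≤-Reasoning
        f g : ℕ → ℕ
        f i = count (λ j → sq i ∣? b + A * j) L
        g i = count (λ j → sq i ∣? b′ + A′ * j) L

      count-bad<4K+1 : count bad? (suc (4 * K)) < suc (4 * K)
      count-bad<4K+1 = *-cancelˡ-< (4 * (4 + K)) (count bad? (suc (4 * K))) (suc (4 * K))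
        (≤-trans (s≤s (count-bad (suc (4 * K)))) (≤-trans (m≤m+n _ (15 + 34 * K)) (≤-reflexive (budget K))))

    avoid-squares : ∃ λ j → j ≤ 4 * K ×
      (∀ i → i < K → ¬ (5 + i) * (5 + i) ∣ b + A * j × ¬ (5 + i) * (5 + i) ∣ b′ + A′ * j)
    avoid-squares =
      let j , j<L , ¬bad = count<⇒∃¬ bad? (suc (4 * K)) count-bad<4K+1
      in j , s≤s⁻¹ j<L , λ i i<K → (λ d∣ → ¬bad (i , i<K , inj₁ d∣)) , (λ d∣ → ¬bad (i , i<K , inj₂ d∣))

module NearSquares where
  open Counting using (avoid-squares)
  open import Data.Nat using (ℕ; zero; suc; _+_; _*_; _≤_; _<_; _<?_; z≤n; s≤s)
  open import Data.Nat.Base using (>-nonZero; nonTrivial⇒≢1)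
  open import Data.Nat.Properties
  open import Data.Nat.DivMod using (_%_; [m+kn]%n≡m%n)
  open import Data.Nat.Divisibility
  open import Data.Nat.Coprimality using (Coprime; coprime-divisor)
  import Data.Nat.Coprimality as Coprime
  open import Data.Nat.Primality using (Prime; euclidsLemma; prime⇒nonTrivial; prime⇒nonZero)
  open import Data.Nat.Primality.Factorisation using (factorise)
  open import Data.Nat.Tactic.RingSolver using (solve-∀)
  open import Data.List using ([]; _∷_)
  open import Data.List.Relation.Unary.All using (_∷_)
  open import Data.Product using (_×_; _,_; ∃; ∃₂; proj₁; proj₂)
  open import Data.Sum using (inj₁; inj₂)
  open import Function using (_∘_)
  open import Relation.Nullary using (¬_; yes; no; contradiction)
  open import Relation.Binary.PropositionalEquality

  private
    regroup : ∀ k q b → k * q * b ≡ q * (k * b)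
    regroup = solve-∀

    expand-near-square : ∀ t n r → t * t * (n * n + r) ≡ (t * n) * (t * n) + t * (t * r)
    expand-near-square = solve-∀

    expand-successor-square : ∀ t n → suc ((t * n) * (t * n) + t * (2 * n)) ≡ suc (t * n) * suc (t * n)
    expand-successor-square = solve-∀

    D-near-square : ∀ s j → 2 * (1 + 6 * j) * ((1 + 18 * (s * s)) + 108 * (s * s) * j)
      ≡ (6 * s * (1 + 6 * j)) * (6 * s * (1 + 6 * j)) + 2 * (1 + 6 * j)
    D-near-square = solve-∀

    D-mod-4 : ∀ s j → 2 * (1 + 6 * j) * ((1 + 18 * (s * s)) + 108 * (s * s) * j)
      ≡ 2 + (3 * j + 3 * (3 * (s * s) + 18 * (s * s) * j) + 18 * j * (3 * (s * s) + 18 * (s * s) * j)) * 4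
    D-mod-4 = solve-∀

    f-as-1+2* : ∀ j → 1 + 6 * j ≡ 1 + 2 * (3 * j)
    f-as-1+2* = solve-∀

    g-as-1+2f* : ∀ s j → (1 + 18 * (s * s)) + 108 * (s * s) * j ≡ 1 + 2 * (1 + 6 * j) * (9 * (s * s))
    g-as-1+2f* = solve-∀

    margin : ∀ s f → 6 * s * (2 * f) ≡ 2 * (6 * s * f)
    margin = solve-∀

    g-mod-6 : ∀ s j → (1 + 18 * (s * s)) + 108 * (s * s) * j ≡ 1 + 6 * (3 * (s * s) + 18 * (s * s) * j)
    g-mod-6 = solve-∀

    six-times : ∀ S → 6 * (1 + 18 * S) ≡ 108 * S + 6
    six-times = solve-∀

    six-times-three : ∀ S → 6 * (3 * S) ≡ 18 * S
    six-times-three = solve-∀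

    square-gap : ∀ S → (1 + 18 * S) + 108 * S * (4 * (500 * S)) + (24 + 4982 * S + 34000 * (S * S))
      ≡ (5 + 500 * S) * (5 + 500 * S)
    square-gap = solve-∀

  prime-divisor : ∀ n → 2 ≤ n → ∃ λ q → Prime q × q ∣ n
  prime-divisor n@(suc _) 2≤n with factorise n
  ... | record { factors = [] ; isFactorisation = n≡Π } = contradiction n≡Π (>⇒≢ 2≤n)
  ... | record { factors = q ∷ qs ; isFactorisation = n≡Π ; factorsPrime = q-prime ∷ _ } =
    q , q-prime , subst (q ∣_) (sym n≡Π) (m∣m*n _)

  SquareFree⇒≢0 : ∀ {x} → SquareFree x → x ≢ 0
  SquareFree⇒≢0 x-squarefree refl with () ← x-squarefree 2 (4 ∣0)

  prime²∣*⇒prime²∣ : ∀ {q a b} → Prime q → Coprime a b → q ∣ a → q * q ∣ a * b → q * q ∣ a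
  prime²∣*⇒prime²∣ {q} {a} {b} q-prime a⊥b (divides k refl) q²∣kqb =
    *-monoˡ-∣ q (coprime-divisor q⊥b (subst (q ∣_) (*-comm k b) q∣kb))
    where
    instance _ = prime⇒nonZero q-prime
    q⊥b : Coprime q b
    q⊥b (c∣q , c∣b) = a⊥b (∣-trans c∣q (n∣m*n k) , c∣b)
    q∣kb : q ∣ k * b
    q∣kb = *-cancelˡ-∣ q (subst (q * q ∣_) (regroup k q b) q²∣kqb)

  prime²∤ : ∀ {q a b} → Prime q → Coprime a b → SquareFree a → SquareFree b → ¬ q * q ∣ a * b
  prime²∤ {q} {a} {b} q-prime a⊥b a-sf b-sf q²∣ab with euclidsLemma a b q-prime (∣-trans (m∣m*n q) q²∣ab)
  ... | inj₁ q∣a = nonTrivial⇒≢1 {{prime⇒nonTrivial q-prime}} (a-sf q (prime²∣*⇒prime²∣ q-prime a⊥b q∣a q²∣ab))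
  ... | inj₂ q∣b = nonTrivial⇒≢1 {{prime⇒nonTrivial q-prime}}
    (b-sf q (prime²∣*⇒prime²∣ q-prime (Coprime.sym a⊥b) q∣b (subst (q * q ∣_) (*-comm a b) q²∣ab)))

  SquareFree-* : ∀ {a b} → Coprime a b → SquareFree a → SquareFree b → SquareFree (a * b)
  SquareFree-* {a} {b} a⊥b a-sf b-sf zero 0∣ab with m*n≡0⇒m≡0∨n≡0 a (0∣⇒≡0 0∣ab)
  ... | inj₁ a≡0 = contradiction a≡0 (SquareFree⇒≢0 a-sf)
  ... | inj₂ b≡0 = contradiction b≡0 (SquareFree⇒≢0 b-sf)
  SquareFree-* a⊥b a-sf b-sf 1 _ = refl
  SquareFree-* a⊥b a-sf b-sf p@(suc (suc _)) p²∣ab =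
    let q , q-prime , q∣p = prime-divisor p (s≤s (s≤s z≤n))
    in contradiction (∣-trans (*-pres-∣ q∣p q∣p) p²∣ab) (prime²∤ q-prime a⊥b a-sf b-sf)

  squareFree-below : ∀ {x} B → 0 < x → x < B * B → (∀ d → 2 ≤ d → d < B → ¬ d * d ∣ x) → SquareFree x
  squareFree-below B x>0 x<B² no-small zero 0∣x = contradiction (0∣⇒≡0 0∣x) (>⇒≢ x>0)
  squareFree-below B x>0 x<B² no-small 1 _ = refl
  squareFree-below {x} B x>0 x<B² no-small d@(suc (suc _)) d²∣x with d <? B
  ... | yes d<B = contradiction d²∣x (no-small d (s≤s (s≤s z≤n)) d<B)
  ... | no  d≮B = contradiction x<B² (≤⇒≯ (begin
    B * B ≤⟨ *-mono-≤ (≮⇒≥ d≮B) (≮⇒≥ d≮B) ⟩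
    d * d ≤⟨ ∣⇒≤ {{>-nonZero x>0}} d²∣x ⟩
    x     ∎))
    where open ≤-Reasoning

  ∤1+ : ∀ {p a} → 2 ≤ p → p ∣ a → ¬ p ∣ 1 + a
  ∤1+ {p} {a} 2≤p p∣a p∣1+a = >⇒≢ 2≤p (∣1⇒≡1 (∣m+n∣m⇒∣n (subst (p ∣_) (+-comm 1 a) p∣1+a) p∣a))

  -- Numbers ≡ 1 (mod 6) have no square divisor d² with 2 ≤ d ≤ 4, so only d ≥ 5 must be excluded.
  squareFree-1+6* : ∀ m K → 1 + 6 * m < (5 + K) * (5 + K) →
    (∀ i → i < K → ¬ (5 + i) * (5 + i) ∣ 1 + 6 * m) → SquareFree (1 + 6 * m)
  squareFree-1+6* m K x<B² large = squareFree-below (5 + K) (s≤s z≤n) x<B² no-square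
    where
    2∣6m : 2 ∣ 6 * m
    2∣6m = ∣-trans (divides 3 refl) (m∣m*n m)
    3∣6m : 3 ∣ 6 * m
    3∣6m = ∣-trans (divides 2 refl) (m∣m*n m)
    no-square : ∀ d → 2 ≤ d → d < 5 + K → ¬ d * d ∣ 1 + 6 * m
    no-square 1 (s≤s ()) _
    no-square 2 _ _ = ∤1+ (s≤s (s≤s z≤n)) 2∣6m ∘ ∣-trans (divides 2 refl)
    no-square 3 _ _ = ∤1+ (s≤s (s≤s z≤n)) 3∣6m ∘ ∣-trans (divides 3 refl)
    no-square 4 _ _ = ∤1+ (s≤s (s≤s z≤n)) 2∣6m ∘ ∣-trans (divides 8 refl)
    no-square (suc (suc (suc (suc (suc i))))) _ d<5+K = large i (+-cancelˡ-< 5 i K d<5+K)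

  coprime-1+* : ∀ a k → Coprime a (1 + a * k)
  coprime-1+* a k {c} (c∣a , c∣1+ak) = ∣1⇒≡1 (∣m+n∣m⇒∣n (subst (c ∣_) (+-comm 1 (a * k)) c∣1+ak) (∣m⇒∣m*n k c∣a))

  near-square : ∀ t n r → t * r ≤ 2 * n → t * t * (n * n + r) < suc (t * n) * suc (t * n)
  near-square t n r tr≤2n = begin-strict
    t * t * (n * n + r)           ≡⟨ expand-near-square t n r ⟩
    (t * n) * (t * n) + t * (t * r) ≤⟨ +-monoʳ-≤ ((t * n) * (t * n)) (*-monoʳ-≤ t tr≤2n) ⟩
    (t * n) * (t * n) + t * (2 * n) <⟨ n<1+n _ ⟩
    suc ((t * n) * (t * n) + t * (2 * n)) ≡⟨ expand-successor-square t n ⟩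
    suc (t * n) * suc (t * n)     ∎
    where open ≤-Reasoning

  private
    coprime-108S : ∀ S → Coprime (108 * S) (1 + 18 * S)
    coprime-108S S {c} (c∣108S , c∣1+18S) = ∣1⇒≡1 (∣m+n∣m⇒∣n (subst (c ∣_) (+-comm 1 (18 * S)) c∣1+18S) c∣18S)
      where
      c∣6 : c ∣ 6
      c∣6 = ∣m+n∣m⇒∣n (subst (c ∣_) (six-times S) (∣n⇒∣m*n 6 c∣1+18S)) c∣108S
      c∣18S : c ∣ 18 * S
      c∣18S = subst (c ∣_) (six-times-three S) (∣m⇒∣m*n (3 * S) c∣6)

    2-squarefree : SquareFree 2
    2-squarefree = squareFree-below 2 (s≤s z≤n) (s≤s (s≤s (s≤s z≤n)))
      λ d 2≤d d<2 → contradiction (<-≤-trans d<2 2≤d) (<-irrefl refl)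

  -- D = 2 f g with f = 1 + 6 j and g = 1 + 18 s² f, so that D = (6 s f)² + 2 f lies just above a square.
  module NearSquare (s₀ : ℕ) where

    s S K : ℕ
    s = suc s₀
    S = s * s
    K = 500 * S

    g<[5+K]² : ∀ j → j ≤ 4 * K → (1 + 18 * S) + 108 * S * j < (5 + K) * (5 + K)
    g<[5+K]² j j≤4K = begin-strict
      (1 + 18 * S) + 108 * S * j       ≤⟨ +-monoʳ-≤ (1 + 18 * S) (*-monoʳ-≤ (108 * S) j≤4K) ⟩
      (1 + 18 * S) + 108 * S * (4 * K) <⟨ m<m+n _ (s≤s z≤n) ⟩
      (1 + 18 * S) + 108 * S * (4 * K) + (24 + 4982 * S + 34000 * (S * S)) ≡⟨ square-gap S ⟩
      (5 + K) * (5 + K)                ∎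
      where open ≤-Reasoning

    module _ (j : ℕ) where

      f g D n : ℕ
      f = 1 + 6 * j
      g = (1 + 18 * S) + 108 * S * j
      D = 2 * f * g
      n = 6 * s * f

      D≡n²+2f : D ≡ n * n + 2 * f
      D≡n²+2f = D-near-square s j

      n²≤D : n * n ≤ D
      n²≤D = ≤-trans (m≤m+n (n * n) (2 * f)) (≤-reflexive (sym D≡n²+2f))

      s≤D : s ≤ D
      s≤D = ≤-trans (≤-trans (m≤n*m s 6) (m≤m*n (6 * s) f)) (≤-trans (m≤m*n n n) n²≤D)

      2≤D : 2 ≤ D
      2≤D = ≤-trans (*-monoʳ-≤ 2 (s≤s z≤n)) (≤-trans (m≤n+m (2 * f) (n * n)) (≤-reflexive (sym D≡n²+2f)))

      D%4≡2 : D % 4 ≡ 2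
      D%4≡2 = trans (cong (_% 4) (D-mod-4 s j)) ([m+kn]%n≡m%n 2 (3 * j + 3 * (3 * S + 18 * S * j) + 18 * j * (3 * S + 18 * S * j)) 4)

      D-above-square : ∀ t → t ≤ 6 * s → t * t * D < suc (t * n) * suc (t * n)
      D-above-square t t≤6s = subst (λ x → t * t * x < suc (t * n) * suc (t * n)) (sym D≡n²+2f)
        (near-square t n (2 * f) (≤-trans (*-monoˡ-≤ (2 * f) t≤6s) (≤-reflexive (margin s f))))

      D-squarefree : j ≤ 4 * K → (∀ i → i < K → ¬ (5 + i) * (5 + i) ∣ f × ¬ (5 + i) * (5 + i) ∣ g) → SquareFree D
      D-squarefree j≤4K avoids = SquareFree-* 2f⊥g (SquareFree-* 2⊥f 2-squarefree f-squarefree) g-squarefree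
        where
        f≤g : f ≤ g
        f≤g = +-mono-≤ (m≤m+n 1 (18 * S)) (*-monoˡ-≤ j (≤-trans (m≤m+n 6 102) (m≤m*n 108 S)))
        f-squarefree : SquareFree f
        f-squarefree = squareFree-1+6* j K (≤-<-trans f≤g (g<[5+K]² j j≤4K)) (λ i i<K → proj₁ (avoids i i<K))
        g-squarefree : SquareFree g
        g-squarefree = subst SquareFree (sym (g-mod-6 s j))
          (squareFree-1+6* (3 * S + 18 * S * j) K (subst (_< (5 + K) * (5 + K)) (g-mod-6 s j) (g<[5+K]² j j≤4K))
            (λ i i<K → subst (λ x → ¬ (5 + i) * (5 + i) ∣ x) (g-mod-6 s j) (proj₂ (avoids i i<K))))
        2⊥f : Coprime 2 f
        2⊥f = subst (Coprime 2) (sym (f-as-1+2* j)) (coprime-1+* 2 (3 * j))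
        2f⊥g : Coprime (2 * f) g
        2f⊥g = subst (Coprime (2 * f)) (sym (g-as-1+2f* s j)) (coprime-1+* (2 * f) (9 * S))

  -- Opaque because the witness is found by a search that the type checker must never unfold.
  opaque
    squarefree-near-squares : ∀ T N → ∃₂ λ D n → N < D × 2 ≤ D × SquareFree D × D % 4 ≡ 2 × n * n ≤ D ×
      (∀ t → t ≤ T → t * t * D < suc (t * n) * suc (t * n))
    squarefree-near-squares T N =
      let j , j≤4K , avoids = avoid-squares {6} {1} {108 * S} {1 + 18 * S} (λ (_ , c∣1) → ∣1⇒≡1 c∣1) (coprime-108S S) K
      in D j , n j , <-≤-trans (s≤s (m≤m+n N T)) (s≤D j) , 2≤D j , D-squarefree j j≤4K avoids , D%4≡2 j , n²≤D j ,
         λ t t≤T → D-above-square j t (≤-trans t≤T (≤-trans (m≤n+m T (suc N)) (m≤n*m s 6)))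
      where open NearSquare (N + T)

open Forms using (no-universal-form-ℤ[√D]; tr≡0)
open NearSquares using (squarefree-near-squares)
open import Data.Nat using (ℕ; _≤_; _<_; _*_; _^_)
open import Data.Product using (_×_; _,_; ∃)
open import Relation.Nullary using (¬_)

theorem1 : (M : ℕ) → 1 ≤ M → (N : ℕ) →
    ∃ λ D → N < D × 2 ≤ D × SquareFree D ×
      ((Q : QForm M) → TotPosDef D M Q → ¬ Universal D M Q)
theorem1 M _ N with squarefree-near-squares (2 * 4 ^ M) N
... | D , n , N<D , 2≤D , D-squarefree , D%4≡2 , n²≤D , β≻0 =
  D , N<D , 2≤D , D-squarefree , no-universal-form-ℤ[√D] n (tr≡0 D D%4≡2) n²≤D β≻0
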